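{- Let $r\ge 2$ be an integer. The signed bi-graph $(K_r,\pm)$ can be obtained, starting from copies of $(K_{2r-2},+)$, by finitely many applications of Operations (sb1)–(sb4) and (sb5)$_{2r-3}$.
   Context: A bi-graph is a loopless multigraph with at most two edges between any two distinct vertices. A signed bi-graph $(G,\sigma)$ is a bi-graph $G$ with a map $\sigma\colon E(G)\to\{1,-1\}$ such that any two parallel edges have distinct signs; an edge is positive if its sign is $1$, negative otherwise. Two distinct vertices are adjacent (neighbours) if at least one edge joins them. $(K_n,+)$ is the complete simple graph on $n$ vertices with all edges positive. $(K_n,\pm)$ is the signed bi-graph on $n$ vertices in which every two distinct vertices are joined by exactly one positive and one negative edge. For an integer $k\ge0$, a signed bi-graph is $k$-thin if it is obtained from some $(K_n,\pm)$ by deleting at most $k$ pairwise vertex-disjoint edges. Operations (with integer parameter $p\ge 1$ in (sb5)$_p$): (sb1) Add vertices or signed edges (the result remaining a signed bi-graph). (sb2) Identify two nonadjacent vertices. (sb3) Given two vertex-disjoint signed bi-graphs $(G_1,\sigma_1)$, $(G_2,\sigma_2)$, a vertex $v$ of $G_1$ and a positive edge $e$ of $G_2$ with ends $x,y$: split $v$ into two new vertices $v_1,v_2$ (each edge formerly incident with $v$ becomes incident with exactly one of $v_1,v_2$, keeping its other end and sign), remove $e$, and identify $v_1$ with $x$ and $v_2$ with $y$. (sb4) Switch at a vertex $v$: negate the sign of every edge incident with $v$. (sb5)$_p$ If $p$ is even, remove a vertex that has at most $p/2$ neighbours; if $p$ is odd, remove a negative edge whose ends are joined by no other edge, identify these two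 ends, and add signed edges so that the resulting signed bi-graph is $\frac{p-3}{2}$-thin. -}

module Defs where

open import Data.Nat using (ℕ; zero; suc; _+_; _*_; _≤_)
open import Data.Fin using (Fin; _≟_)
open import Data.Bool using (Bool; true; false; if_then_else_; _xor_)
open import Data.List using (List; length)
open import Data.List.Membership.Propositional using (_∈_)
open import Data.Product using (Σ; ∃; ∃-syntax; _×_; _,_)
open import Data.Sum using (_⊎_)
open import Data.Empty using (⊥-elim)
open import Relation.Nullary using (¬_; yes; no)
open import Relation.Nullary.Decidable using (⌊_⌋)
open import Relation.Binary.PropositionalEquality using (_≡_; _≢_; refl)
open import Function.Bundles using (_⇔_)
open import Function.Definitions using (Injective)

data Sign : Set where
  plus minus : Sign

flip : Sign → Sign
flip plus = minus
flip minus = plus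

-- Since parallel edges must
-- have distinct signs, the edges joining two distinct vertices are
-- determined by the set of signs occurring among them (a subset of
-- {+,-}).  edge s i j = true  iff  an edge of sign s joins i and j.
record SBG (n : ℕ) : Set where
  field
    edge   : Sign → Fin n → Fin n → Bool
    edge-sym : ∀ s i j → edge s i j ≡ edge s j i
    irrefl : ∀ s i → edge s i i ≡ false
open SBG public

E : ∀ {n} → SBG n → Sign → Fin n → Fin n → Set
E G s i j = edge G s i j ≡ true

Adjacent : ∀ {n} → SBG n → Fin n → Fin n → Set
Adjacent G i j = E G plus i j ⊎ E G minus i j

SamePair : ∀ {n} → Fin n → Fin n → Fin n → Fin n → Set
SamePair a b c d = (a ≡ c × b ≡ d) ⊎ (a ≡ d × b ≡ c)

Surj : ∀ {n m} → (Fin n → Fin m) → Set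
Surj f = ∀ a → ∃[ i ] f i ≡ a

neq : ∀ {n} → Fin n → Fin n → Bool
neq i j = if ⌊ i ≟ j ⌋ then false else true

neq-sym : ∀ {n} (i j : Fin n) → neq i j ≡ neq j i
neq-sym i j with i ≟ j | j ≟ i
... | yes _ | yes _ = refl
... | no _  | no _  = refl
... | yes p | no q  = ⊥-elim (q (Relation.Binary.PropositionalEquality.sym p))
... | no p  | yes q = ⊥-elim (p (Relation.Binary.PropositionalEquality.sym q))

neq-irr : ∀ {n} (i : Fin n) → neq i i ≡ false
neq-irr i with i ≟ i
... | yes _ = refl
... | no p  = ⊥-elim (p refl)

Kplus : (n : ℕ) → SBG n
Kplus n = record
  { edge   = λ { plus i j → neq i j ; minus i j → false }
  ; edge-sym = λ { plus i j → neq-sym i j ; minus i j → refl }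
  ; irrefl = λ { plus i → neq-irr i ; minus i → refl }
  }

Kpm : (n : ℕ) → SBG n
Kpm n = record
  { edge   = λ s i j → neq i j
  ; edge-sym = λ s i j → neq-sym i j
  ; irrefl = λ s i → neq-irr i
  }

-- k-thin: obtained from (K_n,±) by deleting at most k pairwise
-- vertex-disjoint edges.  The deleted edges are indexed by Fin m.

record Thin (k : ℕ) {n : ℕ} (G : SBG n) : Set where
  field
    m        : ℕ
    m≤k      : m ≤ k
    end₁     : Fin m → Fin n
    end₂     : Fin m → Fin n
    sgn      : Fin m → Sign
    proper   : ∀ t → end₁ t ≢ end₂ t
    disjoint : ∀ t t' → t ≢ t' →
                 (end₁ t ≢ end₁ t') × (end₁ t ≢ end₂ t') ×
                 (end₂ t ≢ end₁ t') × (end₂ t ≢ end₂ t')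
    spec     : ∀ s a b → a ≢ b →
                 (edge G s a b ≡ false) ⇔
                 (∃[ t ] (sgn t ≡ s × SamePair a b (end₁ t) (end₂ t)))

-- The operations, as relations "H is obtained from G".
-- Results are only determined up to isomorphism (vertex maps).

IsImage : ∀ {n m} → (Fin n → Fin m) → SBG n → SBG m → Set
IsImage f G H = ∀ s a b →
  E H s a b ⇔ (∃[ i ] ∃[ j ] (f i ≡ a × f j ≡ b × E G s i j))

IdentifiesExactly : ∀ {n m} → (Fin n → Fin m) → Fin n → Fin n → Set
IdentifiesExactly f u v =
  Surj f × f u ≡ f v × (∀ i j → f i ≡ f j → i ≡ j ⊎ SamePair i j u v)

-- (sb1) add vertices and/or signed edges: H contains a copy of G
record SB1 {n m} (G : SBG n) (H : SBG m) : Set where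
  field
    f     : Fin n → Fin m
    f-inj : Injective _≡_ _≡_ f
    pres  : ∀ s i j → E G s i j → E H s (f i) (f j)

record SB2 {n m} (G : SBG n) (H : SBG m) : Set where
  field
    u v    : Fin n
    u≢v    : u ≢ v
    nonadj : ¬ Adjacent G u v
    f      : Fin n → Fin m
    ident  : IdentifiesExactly f u v
    image  : IsImage f G H

-- (sb3) Hajós-type sum of G₁ (at vertex v) and G₂ (at positive edge xy).
-- side s w = true : the edge of sign s joining v and w goes to v₁ = x,
-- side s w = false: it goes to v₂ = y.
record SB3 {n₁ n₂ m} (G₁ : SBG n₁) (G₂ : SBG n₂) (H : SBG m) : Set where
  field
    v     : Fin n₁
    x y   : Fin n₂
    exy   : E G₂ plus x y
    side  : Sign → Fin n₁ → Bool
    f     : Fin n₁ → Fin m      -- embeds G₁ - v (value at v irrelevant)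
    g     : Fin n₂ → Fin m
    f-inj : ∀ i j → i ≢ v → j ≢ v → f i ≡ f j → i ≡ j
    g-inj : Injective _≡_ _≡_ g
    disj  : ∀ i j → i ≢ v → f i ≢ g j
    onto  : ∀ a → (∃[ i ] (i ≢ v × f i ≡ a)) ⊎ (∃[ j ] g j ≡ a)
    edges : ∀ s a b → E H s a b ⇔
      ( (∃[ i ] ∃[ j ] (i ≢ v × j ≢ v × E G₁ s i j × f i ≡ a × f j ≡ b))
      ⊎ (∃[ i ] ∃[ j ] (E G₂ s i j × ¬ (s ≡ plus × SamePair i j x y)
                          × g i ≡ a × g j ≡ b))
      ⊎ (∃[ w ] (E G₁ s v w ×
            ((g (if side s w then x else y) ≡ a × f w ≡ b)
             ⊎ (f w ≡ a × g (if side s w then x else y) ≡ b)))) )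

record SB4 {n} (G : SBG n) (H : SBG n) : Set where
  field
    v     : Fin n
    edges : ∀ s i j → edge H s i j ≡
              edge G (if (⌊ i ≟ v ⌋ xor ⌊ j ≟ v ⌋) then flip s else s) i j

record RemoveVertex (q : ℕ) {n m} (G : SBG n) (H : SBG m) : Set where
  field
    v       : Fin n
    nbrs    : List (Fin n)
    few     : length nbrs ≤ q
    covers  : ∀ w → Adjacent G v w → w ∈ nbrs
    f       : Fin m → Fin n
    f-inj   : Injective _≡_ _≡_ f
    f-avoid : ∀ a → f a ≢ v
    f-onto  : ∀ w → w ≢ v → ∃[ a ] f a ≡ w
    edges   : ∀ s a b → edge H s a b ≡ edge G s (f a) (f b)

-- (sb5)_p, p = 2k+3 odd: remove a negative edge uv whose ends are joined
-- by no other edge, identify u and v, and add signed edges so that the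
-- result is k-thin (k = (p-3)/2).
record Contract (k : ℕ) {n m} (G : SBG n) (H : SBG m) : Set where
  field
    u v    : Fin n
    u≢v    : u ≢ v
    euv    : E G minus u v
    only   : ¬ E G plus u v
    f      : Fin n → Fin m
    ident  : IdentifiesExactly f u v
    keeps  : ∀ s i j → E G s i j → ¬ SamePair i j u v → E H s (f i) (f j)
    thin   : Thin k H

SB5 : (p : ℕ) → ∀ {n m} → SBG n → SBG m → Set
SB5 p G H = (∃[ q ] (p ≡ 2 * q × RemoveVertex q G H))
          ⊎ (∃[ k ] (p ≡ 2 * k + 3 × Contract k G H))

data Obtainable (b p : ℕ) : ∀ {n} → SBG n → Set where
  base : Obtainable b p (Kplus b)
  sb1  : ∀ {n m} {G : SBG n} {H : SBG m} →
         Obtainable b p G → SB1 G H → Obtainable b p H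
  sb2  : ∀ {n m} {G : SBG n} {H : SBG m} →
         Obtainable b p G → SB2 G H → Obtainable b p H
  sb3  : ∀ {n₁ n₂ m} {G₁ : SBG n₁} {G₂ : SBG n₂} {H : SBG m} →
         Obtainable b p G₁ → Obtainable b p G₂ → SB3 G₁ G₂ H →
         Obtainable b p H
  sb4  : ∀ {n} {G H : SBG n} →
         Obtainable b p G → SB4 G H → Obtainable b p H
  sb5  : ∀ {n m} {G : SBG n} {H : SBG m} →
         Obtainable b p G → SB5 p G H → Obtainable b p H

-- Take b = 2r − 2 vertices: r − 2 disjoint pairs and two further vertices.
-- Switching (K_b,+) so that the two ends of every pair lie on opposite sides
-- turns each pair into a lone negative edge; adding all other edges gives
-- (K_b,±) with the positive edges of the pairs deleted.  Contracting one pair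
-- leaves (K_{b−1},±) minus the positive edges of the t ≤ r − 3 remaining
-- pairs, which is (r − 3)-thin, as (sb5)_{2r−3} demands.  After r − 2
-- contractions (K_r,±) remains.
module Submission where

open import Defs
open import Data.Nat using (ℕ; zero; suc; _+_; _*_; _∸_; _≤_; s≤s)
open import Data.Nat.Properties using (+-suc; +-comm; ≤-refl; ≤-trans; n≤1+n)
open import Data.Nat.Tactic.RingSolver using (solve-∀)
open import Data.Fin using (Fin; zero; suc; _≟_)
open import Data.Fin.Properties using (suc-injective)
open import Data.Bool using (Bool; true; false; not; _∧_; _xor_; if_then_else_)
open import Data.Bool.Properties
  using (xor-comm; xor-∧-commutativeRing; ∧-conicalʳ; ∧-identityʳ; not-injective)
open import Algebra.Bundles using (CommutativeRing)
open import Algebra.Properties.CommutativeSemigroup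
  (CommutativeRing.+-commutativeSemigroup xor-∧-commutativeRing) using (interchange)
open import Data.List using (List; []; _∷_; map)
open import Data.Product using (∃-syntax; _×_; _,_)
open import Data.Sum using (_⊎_; inj₁; inj₂; [_,_])
open import Data.Empty using (⊥-elim)
open import Relation.Nullary using (¬_; yes; no)
open import Relation.Nullary.Decidable using (⌊_⌋)
open import Relation.Binary.PropositionalEquality
  using (_≡_; _≢_; refl; sym; trans; cong; cong₂; subst; subst₂)
open import Function using (_∘_)
open import Function.Bundles using (_⇔_; mk⇔)

private
  variable
    b p n : ℕ

neq-true : (i j : Fin n) → i ≢ j → neq i j ≡ true
neq-true i j i≢j with i ≟ j
... | yes i≡j = ⊥-elim (i≢j i≡j)
... | no _    = refl

E⇒≢ : (G : SBG n) {s : Sign} {i j : Fin n} → E G s i j → i ≢ j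
E⇒≢ G {s} {i} e refl with trans (sym (irrefl G s i)) e
... | ()

_⊆_ : SBG n → SBG n → Set
G ⊆ H = ∀ s i j → E G s i j → E H s i j

obtainable-⊆ : {G H : SBG n} → G ⊆ H → Obtainable b p G → Obtainable b p H
obtainable-⊆ G⊆H o = sb1 o (record { f = λ i → i ; f-inj = λ eq → eq ; pres = G⊆H })

Kplus⊆Kpm : Kplus n ⊆ Kpm n
Kplus⊆Kpm plus  i j e = e
Kplus⊆Kpm minus i j ()

flipIf : Bool → Sign → Sign
flipIf c s = if c then flip s else s

flipIf-flipIf : ∀ c d s → flipIf c (flipIf d s) ≡ flipIf (d xor c) s
flipIf-flipIf c     false s     = refl
flipIf-flipIf false true  s     = refl
flipIf-flipIf true  true  plus  = refl
flipIf-flipIf true  true  minus = refl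

switch : (Fin n → Bool) → SBG n → SBG n
switch S G = record
  { edge     = λ s i j → edge G (flipIf (S i xor S j) s) i j
  ; edge-sym = λ s i j → trans (cong (λ c → edge G (flipIf c s) i j) (xor-comm (S i) (S j)))
                               (edge-sym G _ i j)
  ; irrefl   = λ s i → irrefl G _ i
  }

switch-switch : (S T : Fin n → Bool) (G : SBG n) → ∀ s i j →
                edge (switch S (switch T G)) s i j ≡ edge (switch (λ v → S v xor T v) G) s i j
switch-switch S T G s i j = cong (λ s′ → edge G s′ i j)
  (trans (flipIf-flipIf (T i xor T j) (S i xor S j) s)
         (cong (λ c → flipIf c s) (interchange (S i) (S j) (T i) (T j))))

switch-cong : {S T : Fin n → Bool} (G : SBG n) → (∀ v → S v ≡ T v) → switch S G ⊆ switch T G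
switch-cong G S≗T s i j = subst (λ c → E G (flipIf c s) i j) (cong₂ _xor_ (S≗T i) (S≗T j))

switchAt : List (Fin n) → Fin n → Bool
switchAt []       i = false
switchAt (v ∷ vs) i = ⌊ i ≟ v ⌋ xor switchAt vs i

obtainable-switchAt : {G : SBG n} → Obtainable b p G → ∀ vs → Obtainable b p (switch (switchAt vs) G)
obtainable-switchAt o []       = obtainable-⊆ (λ s i j e → e) o
obtainable-switchAt {G = G} o (v ∷ vs) = sb4 (obtainable-switchAt o vs) (record
  { v = v ; edges = λ s i j → sym (switch-switch (λ i → ⌊ i ≟ v ⌋) (switchAt vs) G s i j) })

-- ⌊_⌋ remembers the decided proposition, so this does not hold by refl.
⌊suc≟suc⌋ : (i v : Fin n) → ⌊ Fin.suc i ≟ suc v ⌋ ≡ ⌊ i ≟ v ⌋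
⌊suc≟suc⌋ i v with i ≟ v
... | yes _ = refl
... | no _  = refl

switchAt-map-suc-zero : (vs : List (Fin n)) → switchAt (map suc vs) zero ≡ false
switchAt-map-suc-zero []       = refl
switchAt-map-suc-zero (v ∷ vs) = switchAt-map-suc-zero vs

switchAt-map-suc : (vs : List (Fin n)) (i : Fin n) → switchAt (map suc vs) (suc i) ≡ switchAt vs i
switchAt-map-suc []       i = refl
switchAt-map-suc (v ∷ vs) i = cong₂ _xor_ (⌊suc≟suc⌋ i v) (switchAt-map-suc vs i)

switchAt-complete : (S : Fin n → Bool) → ∃[ vs ] (∀ i → switchAt vs i ≡ S i)
switchAt-complete {zero}  S = [] , λ ()
switchAt-complete {suc n} S with switchAt-complete (S ∘ suc) | S zero in S0
... | vs , h | false = map suc vs , λ where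
  zero    → trans (switchAt-map-suc-zero vs) (sym S0)
  (suc i) → trans (switchAt-map-suc vs i) (h i)
... | vs , h | true  = zero ∷ map suc vs , λ where
  zero    → trans (cong (true xor_) (switchAt-map-suc-zero vs)) (sym S0)
  (suc i) → trans (switchAt-map-suc vs i) (h i)

obtainable-switch : {G : SBG n} → Obtainable b p G → ∀ S → Obtainable b p (switch S G)
obtainable-switch {G = G} o S with switchAt-complete S
... | vs , h = obtainable-⊆ (switch-cong G h) (obtainable-switchAt o vs)

-- Vertex sets made of t pairs followed by m further vertices

pairsAnd : ℕ → ℕ → ℕ
pairsAnd zero    m = m
pairsAnd (suc t) m = suc (suc (pairsAnd t m))

pairsAnd≡ : ∀ t m → pairsAnd t m ≡ t + (t + m)
pairsAnd≡ zero    m = refl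
pairsAnd≡ (suc t) m = cong suc (trans (cong suc (pairsAnd≡ t m)) (sym (+-suc t (t + m))))

module _ {m : ℕ} where

  pairFst pairSnd : ∀ t → Fin t → Fin (pairsAnd t m)
  pairFst (suc t) zero    = zero
  pairFst (suc t) (suc x) = suc (suc (pairFst t x))
  pairSnd (suc t) zero    = suc zero
  pairSnd (suc t) (suc x) = suc (suc (pairSnd t x))

  pairFst≢pairSnd : ∀ t x → pairFst t x ≢ pairSnd t x
  pairFst≢pairSnd (suc t) (suc x) eq = pairFst≢pairSnd t x (suc-injective (suc-injective eq))

  pairs-disjoint : ∀ t x y → x ≢ y →
    (pairFst t x ≢ pairFst t y) × (pairFst t x ≢ pairSnd t y) ×
    (pairSnd t x ≢ pairFst t y) × (pairSnd t x ≢ pairSnd t y)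
  pairs-disjoint (suc t) zero    zero    x≢y = ⊥-elim (x≢y refl)
  pairs-disjoint (suc t) zero    (suc y) _   = (λ ()) , (λ ()) , (λ ()) , (λ ())
  pairs-disjoint (suc t) (suc x) zero    _   = (λ ()) , (λ ()) , (λ ()) , (λ ())
  pairs-disjoint (suc t) (suc x) (suc y) x≢y with pairs-disjoint t x y (x≢y ∘ cong suc)
  ... | ff , fs , sf , ss = ff ∘ suc-suc-injective , fs ∘ suc-suc-injective
                          , sf ∘ suc-suc-injective , ss ∘ suc-suc-injective
    where
    suc-suc-injective : ∀ {k} {a c : Fin k} → Fin.suc (Fin.suc a) ≡ suc (suc c) → a ≡ c
    suc-suc-injective = suc-injective ∘ suc-injective

  paired : ∀ t → Fin (pairsAnd t m) → Fin (pairsAnd t m) → Bool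
  paired zero    _             _             = false
  paired (suc t) zero          (suc zero)    = true
  paired (suc t) (suc zero)    zero          = true
  paired (suc t) (suc (suc i)) (suc (suc j)) = paired t i j
  paired (suc t) _             _             = false

  paired-sym : ∀ t i j → paired t i j ≡ paired t j i
  paired-sym zero    i             j             = refl
  paired-sym (suc t) zero          zero          = refl
  paired-sym (suc t) zero          (suc zero)    = refl
  paired-sym (suc t) zero          (suc (suc j)) = refl
  paired-sym (suc t) (suc zero)    zero          = refl
  paired-sym (suc t) (suc zero)    (suc zero)    = refl
  paired-sym (suc t) (suc zero)    (suc (suc j)) = refl
  paired-sym (suc t) (suc (suc i)) zero          = refl
  paired-sym (suc t) (suc (suc i)) (suc zero)    = refl
  paired-sym (suc t) (suc (suc i)) (suc (suc j)) = paired-sym t i j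

  paired-pair : ∀ t x → paired t (pairFst t x) (pairSnd t x) ≡ true
  paired-pair (suc t) zero    = refl
  paired-pair (suc t) (suc x) = paired-pair t x

  samePair→paired : ∀ t i j x → SamePair i j (pairFst t x) (pairSnd t x) → paired t i j ≡ true
  samePair→paired t i j x (inj₁ (refl , refl)) = paired-pair t x
  samePair→paired t i j x (inj₂ (refl , refl)) = trans (paired-sym t _ _) (paired-pair t x)

  paired→samePair : ∀ t i j → paired t i j ≡ true → ∃[ x ] SamePair i j (pairFst t x) (pairSnd t x)
  paired→samePair zero    i             j             ()
  paired→samePair (suc t) zero          zero          ()
  paired→samePair (suc t) zero          (suc zero)    _ = zero , inj₁ (refl , refl)
  paired→samePair (suc t) zero          (suc (suc j)) ()
  paired→samePair (suc t) (suc zero)    zero          _ = zero , inj₂ (refl , refl)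
  paired→samePair (suc t) (suc zero)    (suc zero)    ()
  paired→samePair (suc t) (suc zero)    (suc (suc j)) ()
  paired→samePair (suc t) (suc (suc i)) zero          ()
  paired→samePair (suc t) (suc (suc i)) (suc zero)    ()
  paired→samePair (suc t) (suc (suc i)) (suc (suc j)) e with paired→samePair t i j e
  ... | x , inj₁ (refl , refl) = suc x , inj₁ (refl , refl)
  ... | x , inj₂ (refl , refl) = suc x , inj₂ (refl , refl)

  side : ∀ t → Fin (pairsAnd t m) → Bool
  side zero    _             = false
  side (suc t) zero          = true
  side (suc t) (suc zero)    = false
  side (suc t) (suc (suc i)) = side t i

  side-pair : ∀ t x → side t (pairFst t x) xor side t (pairSnd t x) ≡ true
  side-pair (suc t) zero    = refl
  side-pair (suc t) (suc x) = side-pair t x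

  paired→sidesDiffer : ∀ t i j → paired t i j ≡ true → side t i xor side t j ≡ true
  paired→sidesDiffer t i j e with paired→samePair t i j e
  ... | x , inj₁ (refl , refl) = side-pair t x
  ... | x , inj₂ (refl , refl) = trans (xor-comm (side t _) (side t _)) (side-pair t x)

KpmMinusPairs : ∀ t m → SBG (pairsAnd t m)
KpmMinusPairs t m = record
  { edge     = λ { plus i j → neq i j ∧ not (paired t i j) ; minus i j → neq i j }
  ; edge-sym = λ { plus i j → cong₂ (λ c d → c ∧ not d) (neq-sym i j) (paired-sym t i j)
                 ; minus i j → neq-sym i j }
  ; irrefl   = λ { plus i → cong (_∧ not (paired t i i)) (neq-irr i) ; minus i → neq-irr i }
  }

switch-side⊆KpmMinusPairs : ∀ t m → switch (side t) (Kplus (pairsAnd t m)) ⊆ KpmMinusPairs t m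
switch-side⊆KpmMinusPairs t m s i j e with side t i xor side t j in sides
switch-side⊆KpmMinusPairs t m plus  i j e | false with paired t i j in pij
... | false = trans (∧-identityʳ (neq i j)) e
... | true  with trans (sym sides) (paired→sidesDiffer t i j pij)
...   | ()
switch-side⊆KpmMinusPairs t m minus i j e | true = e

KpmMinusPairs⊆Kpm : ∀ m → KpmMinusPairs 0 m ⊆ Kpm m
KpmMinusPairs⊆Kpm m plus  i j e = trans (sym (∧-identityʳ (neq i j))) e
KpmMinusPairs⊆Kpm m minus i j e = e

thin-KpmMinusPairs : ∀ {k} t m → t ≤ k → Thin k (KpmMinusPairs t m)
thin-KpmMinusPairs t m t≤k = record
  { m = t ; m≤k = t≤k ; end₁ = pairFst t ; end₂ = pairSnd t ; sgn = λ _ → plus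
  ; proper = pairFst≢pairSnd t ; disjoint = pairs-disjoint t ; spec = spec }
  where
  spec : ∀ s i j → i ≢ j → (edge (KpmMinusPairs t m) s i j ≡ false) ⇔
         (∃[ x ] (plus ≡ s × SamePair i j (pairFst t x) (pairSnd t x)))
  spec plus  i j i≢j rewrite neq-true i j i≢j = mk⇔
    (λ e → let x , same = paired→samePair t i j (not-injective e) in x , refl , same)
    (λ { (x , _ , same) → cong not (samePair→paired t i j x same) })
  spec minus i j i≢j rewrite neq-true i j i≢j = mk⇔ (λ ()) (λ { (_ , () , _) })

-- Contracting the first pair into a new vertex placed after the pairs

module _ {m : ℕ} where

  widen : ∀ t → Fin (pairsAnd t m) → Fin (pairsAnd t (suc m))
  widen zero    i             = suc i
  widen (suc t) zero          = zero
  widen (suc t) (suc zero)    = suc zero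
  widen (suc t) (suc (suc i)) = suc (suc (widen t i))

  fresh : ∀ t → Fin (pairsAnd t (suc m))
  fresh zero    = zero
  fresh (suc t) = suc (suc (fresh t))

  widen-injective : ∀ t {i j} → widen t i ≡ widen t j → i ≡ j
  widen-injective zero    eq = suc-injective eq
  widen-injective (suc t) {zero}        {zero}        eq = refl
  widen-injective (suc t) {suc zero}    {suc zero}    eq = refl
  widen-injective (suc t) {zero}        {suc zero}    ()
  widen-injective (suc t) {zero}        {suc (suc _)} ()
  widen-injective (suc t) {suc zero}    {zero}        ()
  widen-injective (suc t) {suc zero}    {suc (suc _)} ()
  widen-injective (suc t) {suc (suc _)} {zero}        ()
  widen-injective (suc t) {suc (suc _)} {suc zero}    ()
  widen-injective (suc t) {suc (suc i)} {suc (suc j)} eq =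
    cong (λ i → suc (suc i)) (widen-injective t (suc-injective (suc-injective eq)))

  fresh≢widen : ∀ t i → fresh t ≢ widen t i
  fresh≢widen (suc t) (suc (suc i)) eq = fresh≢widen t i (suc-injective (suc-injective eq))

  fresh-or-widen : ∀ t a → a ≡ fresh t ⊎ ∃[ i ] widen t i ≡ a
  fresh-or-widen zero    zero          = inj₁ refl
  fresh-or-widen zero    (suc a)       = inj₂ (a , refl)
  fresh-or-widen (suc t) zero          = inj₂ (zero , refl)
  fresh-or-widen (suc t) (suc zero)    = inj₂ (suc zero , refl)
  fresh-or-widen (suc t) (suc (suc a)) with fresh-or-widen t a
  ... | inj₁ refl       = inj₁ refl
  ... | inj₂ (i , refl) = inj₂ (suc (suc i) , refl)

  paired-widen : ∀ t i j → paired t (widen t i) (widen t j) ≡ paired t i j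
  paired-widen zero    i             j             = refl
  paired-widen (suc t) zero          zero          = refl
  paired-widen (suc t) zero          (suc zero)    = refl
  paired-widen (suc t) zero          (suc (suc j)) = refl
  paired-widen (suc t) (suc zero)    zero          = refl
  paired-widen (suc t) (suc zero)    (suc zero)    = refl
  paired-widen (suc t) (suc zero)    (suc (suc j)) = refl
  paired-widen (suc t) (suc (suc i)) zero          = refl
  paired-widen (suc t) (suc (suc i)) (suc zero)    = refl
  paired-widen (suc t) (suc (suc i)) (suc (suc j)) = paired-widen t i j

  paired-fresh : ∀ t j → paired t (fresh t) j ≡ false
  paired-fresh zero    j             = refl
  paired-fresh (suc t) zero          = refl
  paired-fresh (suc t) (suc zero)    = refl
  paired-fresh (suc t) (suc (suc j)) = paired-fresh t j

  merge : ∀ t → Fin (pairsAnd (suc t) m) → Fin (pairsAnd t (suc m))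
  merge t zero          = fresh t
  merge t (suc zero)    = fresh t
  merge t (suc (suc i)) = widen t i

  merge-surjective : ∀ t → Surj (merge t)
  merge-surjective t a with fresh-or-widen t a
  ... | inj₁ refl       = zero , refl
  ... | inj₂ (i , refl) = suc (suc i) , refl

  merge-fibres : ∀ t i j → merge t i ≡ merge t j → i ≡ j ⊎ SamePair i j zero (suc zero)
  merge-fibres t zero          zero          _  = inj₁ refl
  merge-fibres t zero          (suc zero)    _  = inj₂ (inj₁ (refl , refl))
  merge-fibres t (suc zero)    zero          _  = inj₂ (inj₂ (refl , refl))
  merge-fibres t (suc zero)    (suc zero)    _  = inj₁ refl
  merge-fibres t zero          (suc (suc j)) eq = ⊥-elim (fresh≢widen t j eq)
  merge-fibres t (suc zero)    (suc (suc j)) eq = ⊥-elim (fresh≢widen t j eq)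
  merge-fibres t (suc (suc i)) zero          eq = ⊥-elim (fresh≢widen t i (sym eq))
  merge-fibres t (suc (suc i)) (suc zero)    eq = ⊥-elim (fresh≢widen t i (sym eq))
  merge-fibres t (suc (suc i)) (suc (suc j)) eq =
    inj₁ (cong (λ i → suc (suc i)) (widen-injective t eq))

  paired-merge : ∀ t i j → paired (suc t) i j ≡ false → paired t (merge t i) (merge t j) ≡ false
  paired-merge t zero          j             _ = paired-fresh t (merge t j)
  paired-merge t (suc zero)    j             _ = paired-fresh t (merge t j)
  paired-merge t (suc (suc i)) zero          _ = trans (paired-sym t _ _) (paired-fresh t (widen t i))
  paired-merge t (suc (suc i)) (suc zero)    _ = trans (paired-sym t _ _) (paired-fresh t (widen t i))
  paired-merge t (suc (suc i)) (suc (suc j)) e = trans (paired-widen t i j) e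

contract-firstPair : ∀ {k} t m → t ≤ k →
                     Contract k (KpmMinusPairs (suc t) m) (KpmMinusPairs t (suc m))
contract-firstPair t m t≤k = record
  { u = zero ; v = suc zero ; u≢v = λ () ; euv = refl ; only = λ ()
  ; f = merge t ; ident = merge-surjective t , refl , merge-fibres t
  ; keeps = keeps ; thin = thin-KpmMinusPairs t (suc m) t≤k }
  where
  G = KpmMinusPairs (suc t) m
  merged≢ : ∀ s i j → E G s i j → ¬ SamePair i j zero (suc zero) → merge t i ≢ merge t j
  merged≢ s i j e notPair eq = [ E⇒≢ G {s} e , notPair ] (merge-fibres t i j eq)
  keeps : ∀ s i j → E G s i j → ¬ SamePair i j zero (suc zero) →
          E (KpmMinusPairs t (suc m)) s (merge t i) (merge t j)
  keeps plus  i j e notPair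
    rewrite neq-true (merge t i) (merge t j) (merged≢ plus i j e notPair)
          | paired-merge t i j (not-injective (∧-conicalʳ _ _ e)) = refl
  keeps minus i j e notPair = neq-true (merge t i) (merge t j) (merged≢ minus i j e notPair)

contract-pairs : ∀ {k} t m → t ≤ suc k → Obtainable b (2 * k + 3) (KpmMinusPairs t m) →
                 Obtainable b (2 * k + 3) (KpmMinusPairs 0 (t + m))
contract-pairs zero    m _         o = o
contract-pairs {b} {k} (suc t) m (s≤s t≤k) o =
  subst (λ n → Obtainable b (2 * k + 3) (KpmMinusPairs 0 n)) (+-suc t m)
    (contract-pairs t (suc m) (≤-trans t≤k (n≤1+n k))
      (sb5 o (inj₂ (k , refl , contract-firstPair t m t≤k))))

Kpm-obtainable : ∀ k → Obtainable (pairsAnd (suc k) 2) (2 * k + 3) (Kpm (3 + k))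
Kpm-obtainable k = obtainable-⊆ (KpmMinusPairs⊆Kpm (3 + k))
  (subst (λ n → Obtainable (pairsAnd (suc k) 2) (2 * k + 3) (KpmMinusPairs 0 n))
         (cong suc (+-comm k 2))
    (contract-pairs (suc k) 2 ≤-refl
      (obtainable-⊆ (switch-side⊆KpmMinusPairs (suc k) 2) (obtainable-switch base (side (suc k))))))

lemma2p5 : ∀ (r : ℕ) → 2 ≤ r → Obtainable (2 * r ∸ 2) (2 * r ∸ 3) (Kpm r)
lemma2p5 (suc zero) (s≤s ())
lemma2p5 (suc (suc zero))    _ = obtainable-⊆ Kplus⊆Kpm base
lemma2p5 (suc (suc (suc k))) _ =
  subst₂ (λ b p → Obtainable b p (Kpm (3 + k)))
    (trans (cong (2 +_) (pairsAnd≡ k 2)) (vertices k)) (parameter k) (Kpm-obtainable k)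
  where
  -- the right-hand sides are the normal forms of 2 * (3 + n) ∸ 2 and 2 * (3 + n) ∸ 3
  vertices : ∀ n → 2 + (n + (n + 2)) ≡ suc (n + (3 + (n + 0)))
  vertices = solve-∀
  parameter : ∀ n → 2 * n + 3 ≡ n + (3 + (n + 0))
  parameter = solve-∀
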